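{- Let $p$ be an odd prime. For each positive integer $n$ write $H_n=1+\frac12+\cdots+\frac1n=c_n/d_n$ in lowest terms, let $D_n=\mathrm{lcm}(1,2,\ldots,n)$, and let $q_n=D_n/d_n$ (a positive integer). Define $\mathcal{E}_p=\{n: 1<n<p,\ p\mid c_n\}$ and $\mathcal{Q}_p=\{n\ge 1: p\mid q_n\}$. Let $m\in\mathcal{E}_p$. Then $n\in\mathcal{Q}_p$ for every integer $n$ satisfying $m p^a\le n<(m+1)p^a$ for some integer $a\ge1$. Conversely, if $n\in\mathcal{Q}_p$, then there exist $m\in\mathcal{E}_p$ and an integer $a\ge1$ such that $m p^a\le n<(m+1)p^a$.
   Context: $H_n=c_n/d_n$ with $\gcd(c_n,d_n)=1$; $D_n=\mathrm{lcm}(1,\ldots,n)$; $q_n=D_n/d_n$. -}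

module Defs where

open import Data.Nat as ℕ using (ℕ; zero; suc)
open import Data.Nat.LCM using (lcm)
open import Data.Integer using (ℤ; +_)
open import Data.Rational using (ℚ; _/_; _+_; 0ℚ)
import Data.Rational as ℚ

H : ℕ → ℚ
H zero    = 0ℚ
H (suc n) = H n + ((+ 1) / suc n)

-- c n / d n is H n in lowest terms (stdlib ℚ is always normalised, d n > 0)
c : ℕ → ℤ
c n = ℚ.↥ (H n)

d : ℕ → ℕ
d n = ℚ.ℚ.denominatorℕ (H n)

D : ℕ → ℕ
D zero    = 1
D (suc n) = lcm (D n) (suc n)

-- q n = D n / d n   (d n always divides D n)
q : ℕ → ℕ
q n = D n ℕ./ d n

{-# OPTIONS --safe #-}
-- For any common multiple L of 1, …, n put S(L, n) = Σ_{k ≤ n} L/k = L·H_n. Taking L = D_n gives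
-- S(D_n, n) = c_n q_n and D_n = q_n d_n, so, c_n and d_n being coprime, p ∣ q_n exactly when p
-- divides both D_n and S(D_n, n). Let P = p^a with a ≥ 1 and mP ≤ n < (m+1)P, m < p; then p^a is
-- the exact power of p in D_n. Every term D_n/k of S(D_n, n) with P ∤ k is divisible by p, and the
-- terms with k = iP add up to S(D_n/P, m) = (D_n/P)·c_m/d_m. As p divides neither D_n/P nor d_m,
-- p ∣ S(D_n, n) if and only if p ∣ c_m.
module Submission where

open import Defs
open import Data.Nat using (ℕ; _*_; _^_; _≤_; _<_; suc)
open import Data.Nat.Primality using (Prime)
open import Data.Nat.Divisibility using (_∣_)
open import Data.Integer using (+_)
open import Data.Integer.Divisibility using () renaming (_∣_ to _∣ℤ_)
open import Data.Product using (_×_; Σ)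
open import Relation.Nullary using (¬_)

open import Data.Nat
  using (zero; _+_; _∸_; _/_; _%_; pred; s≤s; s≤s⁻¹; z≤n; NonZero; nonTrivial⇒n>1;
         ≢-nonZero; ≢-nonZero⁻¹; >-nonZero; >-nonZero⁻¹)
open import Data.Nat.Properties
open import Data.Nat.Divisibility
open import Data.Nat.DivMod
  using (m*n/n≡m; m/n*n≡m; m/n*n≤m; m/n/o≡m/[n*o]; /-congʳ; m≥n⇒m/n>0; m<n*o⇒m/o<n; m%n<n; m≡m%n+[m/n]*n)
open import Data.Nat.GCD using (gcd)
open import Data.Nat.LCM using (lcm; m∣lcm[m,n]; n∣lcm[m,n]; lcm-least; gcd*lcm)
open import Data.Nat.Coprimality as Coprime using (Coprime; coprime-divisor)
open import Data.Nat.Primality using (euclidsLemma; prime⇒nonZero; prime⇒nonTrivial)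
open import Data.Nat.Induction using (<-wellFounded)
open import Data.Nat.Tactic.RingSolver using (solve-∀)
open import Data.Integer as ℤ using (ℤ)
import Data.Integer.Properties as ℤ
open import Data.Integer.Tactic.RingSolver using () renaming (solve-∀ to solve-∀ℤ)
open import Data.Rational as ℚ using (ℚ)
import Data.Rational.Properties as ℚ
open import Data.Rational.Unnormalised as ℚᵘ using (mkℚᵘ; _≃_; *≡*)
import Data.Rational.Unnormalised.Properties as ℚᵘ
open import Data.Product using (∃-syntax; ∃₂; _,_)
open import Data.Sum using (inj₁; inj₂; [_,_]′)
open import Data.Empty using (⊥-elim)
open import Function.Bundles using (_⇔_; mk⇔; Equivalence)
open import Induction.WellFounded using (Acc; acc)
open import Relation.Nullary using (yes; no)
open import Relation.Binary.PropositionalEquality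
open import Relation.Binary.Bundles using (Preorder)
import Relation.Binary.Reasoning.Preorder as PreorderReasoning
open import Level using (0ℓ)

m<[1+m/n]*n : ∀ m n .{{_ : NonZero n}} → m < suc (m / n) * n
m<[1+m/n]*n m n = begin-strict
  m                 ≡⟨ m≡m%n+[m/n]*n m n ⟩
  m % n + m / n * n <⟨ +-monoˡ-< (m / n * n) (m%n<n m n) ⟩
  n + m / n * n     ∎
  where open ≤-Reasoning

suc[m*n+pred[n]]≡[1+m]*n : ∀ m n .{{_ : NonZero n}} → suc (m * n + pred n) ≡ suc m * n
suc[m*n+pred[n]]≡[1+m]*n m n = begin
  suc (m * n + pred n) ≡⟨ +-suc (m * n) (pred n) ⟨
  m * n + suc (pred n) ≡⟨ cong (_+_ (m * n)) (suc-pred n) ⟩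
  m * n + n            ≡⟨ +-comm (m * n) n ⟩
  suc m * n            ∎
  where open ≡-Reasoning

-- One-sided (x = y + p·B) so that no subtraction is needed.
infix 4 _≡_[mod_]

record _≡_[mod_] (x y p : ℕ) : Set where
  constructor ≡-mod
  field
    quotient : ℕ
    equality : x ≡ y + p * quotient

module _ {p : ℕ} where

  ≡⇒≡-mod : ∀ {x y} → x ≡ y → x ≡ y [mod p ]
  ≡⇒≡-mod {y = y} refl = ≡-mod 0 (sym (trans (cong (_+_ y) (*-zeroʳ p)) (+-identityʳ y)))

  ≡-mod-trans : ∀ {x y z} → x ≡ y [mod p ] → y ≡ z [mod p ] → x ≡ z [mod p ]
  ≡-mod-trans {z = z} (≡-mod B refl) (≡-mod B' refl) = ≡-mod (B' + B) (regroup p z B' B)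
    where
    regroup : ∀ p z B' B → z + p * B' + p * B ≡ z + p * (B' + B)
    regroup = solve-∀

  ≡-mod-+ʳ : ∀ {x y} t → x ≡ y [mod p ] → x + t ≡ y + t [mod p ]
  ≡-mod-+ʳ {y = y} t (≡-mod B refl) = ≡-mod B (regroup p y t B)
    where
    regroup : ∀ p y t B → y + p * B + t ≡ y + t + p * B
    regroup = solve-∀

  +-multiple-≡-mod : ∀ x {t} → p ∣ t → x + t ≡ x [mod p ]
  +-multiple-≡-mod x (divides B refl) = ≡-mod B (cong (_+_ x) (*-comm B p))

  ∣-resp-≡-mod : ∀ {x y} → x ≡ y [mod p ] → p ∣ x ⇔ p ∣ y
  ∣-resp-≡-mod {y = y} (≡-mod B refl) = mk⇔
    (λ p∣x → ∣m+n∣m⇒∣n (subst (p ∣_) (+-comm y (p * B)) p∣x) (m∣m*n B))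
    (λ p∣y → ∣m∣n⇒∣m+n p∣y (m∣m*n B))

≡-mod-preorder : ℕ → Preorder 0ℓ 0ℓ 0ℓ
≡-mod-preorder p = record
  { _≈_        = _≡_
  ; _≲_        = _≡_[mod p ]
  ; isPreorder = record
    { isEquivalence = isEquivalence
    ; reflexive     = ≡⇒≡-mod
    ; trans         = ≡-mod-trans
    }
  }

module ≡-mod-Reasoning (p : ℕ) = PreorderReasoning (≡-mod-preorder p)

-- S(L, n); it equals L·H_n only when every k ≤ n divides L, since _/_ is floor division.
scaledH : ℕ → ℕ → ℕ
scaledH L zero    = 0
scaledH L (suc n) = scaledH L n + L / suc n

add-unit-fraction : ∀ (s e n L : ℤ) → L ≡ e ℤ.* n →
  (s ℤ.* n ℤ.+ + 1 ℤ.* L) ℤ.* L ≡ (s ℤ.+ e) ℤ.* (L ℤ.* n)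
add-unit-fraction s e n _ refl = identity s e n
  where
  identity : ∀ s e n → (s ℤ.* n ℤ.+ + 1 ℤ.* (e ℤ.* n)) ℤ.* (e ℤ.* n) ≡ (s ℤ.+ e) ℤ.* ((e ℤ.* n) ℤ.* n)
  identity = solve-∀ℤ

toℚᵘ-H≃scaledH : ∀ L' n → (∀ k .{{_ : NonZero k}} → k ≤ n → k ∣ suc L') →
  ℚ.toℚᵘ (H n) ≃ mkℚᵘ (+ scaledH (suc L') n) L'
toℚᵘ-H≃scaledH L' zero    _    = *≡* refl
toℚᵘ-H≃scaledH L' (suc n) k∣L with k∣L (suc n) ≤-refl
... | divides e L≡e*k = begin
  ℚ.toℚᵘ (H n ℚ.+ + 1 ℚ./ suc n)
    ≈⟨ ℚ.toℚᵘ-homo-+ (H n) (+ 1 ℚ./ suc n) ⟩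
  ℚ.toℚᵘ (H n) ℚᵘ.+ ℚ.toℚᵘ (+ 1 ℚ./ suc n)
    ≈⟨ ℚᵘ.+-cong (toℚᵘ-H≃scaledH L' n (λ k k≤n → k∣L k (m≤n⇒m≤1+n k≤n)))
                 (ℚ.toℚᵘ-fromℚᵘ (mkℚᵘ (+ 1) n)) ⟩
  mkℚᵘ (+ s) L' ℚᵘ.+ mkℚᵘ (+ 1) n
    ≈⟨ *≡* (trans (add-unit-fraction (+ s) (+ e) (+ suc n) (+ suc L') (trans (cong +_ L≡e*k) (ℤ.pos-* e (suc n))))
                  (sym (cong₂ ℤ._*_ (ℤ.pos-+ s e) (ℤ.pos-* (suc L') (suc n))))) ⟩
  mkℚᵘ (+ (s + e)) L'
    ≡⟨ cong (λ t → mkℚᵘ (+ (s + t)) L') (sym (trans (cong (_/ suc n) L≡e*k) (m*n/n≡m e (suc n)))) ⟩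
  mkℚᵘ (+ scaledH (suc L') (suc n)) L' ∎
  where
  open ℚᵘ.≃-Reasoning
  s = scaledH (suc L') n

∣c∣*L≡scaledH*d : ∀ n L .{{_ : NonZero L}} → (∀ k .{{_ : NonZero k}} → k ≤ n → k ∣ L) →
  ℤ.∣ c n ∣ * L ≡ scaledH L n * d n
∣c∣*L≡scaledH*d n (suc L') k∣L with toℚᵘ-H≃scaledH L' n k∣L
... | *≡* eq = begin
  ℤ.∣ c n ∣ * suc L'                                 ≡⟨ ℤ.abs-* (c n) (+ suc L') ⟨
  ℤ.∣ c n ℤ.* + suc L' ∣                             ≡⟨ cong (λ t → ℤ.∣ t ℤ.* + suc L' ∣) (ℚ.↥ᵘ-toℚᵘ (H n)) ⟨
  ℤ.∣ ℚᵘ.↥ (ℚ.toℚᵘ (H n)) ℤ.* + suc L' ∣             ≡⟨ cong ℤ.∣_∣ eq ⟩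
  ℤ.∣ + scaledH (suc L') n ℤ.* ℚᵘ.↧ (ℚ.toℚᵘ (H n)) ∣ ≡⟨ cong (λ t → ℤ.∣ + scaledH (suc L') n ℤ.* t ∣) (ℚ.↧ᵘ-toℚᵘ (H n)) ⟩
  ℤ.∣ + scaledH (suc L') n ℤ.* ℚ.↧ (H n) ∣          ≡⟨ ℤ.abs-* (+ scaledH (suc L') n) (ℚ.↧ (H n)) ⟩
  scaledH (suc L') n * d n                           ∎
  where open ≡-Reasoning

coprime-↥-↧ : ∀ (x : ℚ) → Coprime ℤ.∣ ℚ.↥ x ∣ (ℚ.ℚ.denominatorℕ x)
coprime-↥-↧ (ℚ.mkℚ _ _ coprime) = Coprime.recompute coprime

lcm≢0 : ∀ m n .{{_ : NonZero m}} .{{_ : NonZero n}} → NonZero (lcm m n)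
lcm≢0 m n = ≢-nonZero λ lcm≡0 → ≢-nonZero⁻¹ (m * n) {{m*n≢0 m n}} (begin
  m * n                 ≡⟨ gcd*lcm m n ⟨
  gcd m n * lcm m n     ≡⟨ cong (gcd m n *_) lcm≡0 ⟩
  gcd m n * 0           ≡⟨ *-zeroʳ (gcd m n) ⟩
  0                     ∎)
  where open ≡-Reasoning

D≢0 : ∀ n → NonZero (D n)
D≢0 zero    = _
D≢0 (suc n) = lcm≢0 (D n) (suc n) {{D≢0 n}}

k∣D : ∀ {k} n .{{_ : NonZero k}} → k ≤ n → k ∣ D n
k∣D {suc _} zero    ()
k∣D {k}     (suc n) k≤1+n with m≤n⇒m<n∨m≡n k≤1+n
... | inj₁ k<1+n = ∣-trans (k∣D n (s≤s⁻¹ k<1+n)) (m∣lcm[m,n] (D n) (suc n))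
... | inj₂ refl  = n∣lcm[m,n] (D n) (suc n)

∣c∣*D≡scaledH*d : ∀ n → ℤ.∣ c n ∣ * D n ≡ scaledH (D n) n * d n
∣c∣*D≡scaledH*d n = ∣c∣*L≡scaledH*d n (D n) {{D≢0 n}} (λ _ → k∣D n)

d∣D : ∀ n → d n ∣ D n
d∣D n = coprime-divisor (Coprime.sym (coprime-↥-↧ (H n))) (divides (scaledH (D n) n) (∣c∣*D≡scaledH*d n))

D≡q*d : ∀ n → D n ≡ q n * d n
D≡q*d n = sym (m/n*n≡m (d∣D n))

scaledH-D≡∣c∣*q : ∀ n → scaledH (D n) n ≡ ℤ.∣ c n ∣ * q n
scaledH-D≡∣c∣*q n = *-cancelʳ-≡ _ _ (d n) (begin
  scaledH (D n) n * d n    ≡⟨ ∣c∣*D≡scaledH*d n ⟨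
  ℤ.∣ c n ∣ * D n          ≡⟨ cong (ℤ.∣ c n ∣ *_) (D≡q*d n) ⟩
  ℤ.∣ c n ∣ * (q n * d n)  ≡⟨ *-assoc ℤ.∣ c n ∣ (q n) (d n) ⟨
  ℤ.∣ c n ∣ * q n * d n    ∎)
  where open ≡-Reasoning

-- The hypothesis kills every term L/k off the multiples of P, and L/(iP) = (L/P)/i on them.
module _ {p L N P : ℕ} .{{_ : NonZero P}}
         (p∣L/k : ∀ k .{{_ : NonZero k}} → k ≤ N → ¬ P ∣ k → p ∣ L / k) where

  scaledH-within-block : ∀ j r → r < P → j * P + r ≤ N →
    scaledH L (j * P + r) ≡ scaledH L (j * P) [mod p ]
  scaledH-within-block j zero    _   _           = ≡⇒≡-mod (cong (scaledH L) (+-identityʳ (j * P)))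
  scaledH-within-block j (suc r) r<P jP+1+r≤N = begin
    scaledH L (j * P + suc r)                   ≡⟨ cong (scaledH L) (+-suc (j * P) r) ⟩
    scaledH L (j * P + r) + L / suc (j * P + r) ≲⟨ +-multiple-≡-mod _ (p∣L/k (suc (j * P + r)) k≤N P∤k) ⟩
    scaledH L (j * P + r)                       ≲⟨ scaledH-within-block j r (<-trans (n<1+n r) r<P)
                                                     (≤-trans (n≤1+n _) k≤N) ⟩
    scaledH L (j * P)                           ∎
    where
    open ≡-mod-Reasoning p
    k≤N : suc (j * P + r) ≤ N
    k≤N = subst (_≤ N) (+-suc (j * P) r) jP+1+r≤N
    P∤k : ¬ P ∣ suc (j * P + r)
    P∤k P∣k = <⇒≱ r<P (∣⇒≤ (∣m+n∣m⇒∣n (subst (P ∣_) (sym (+-suc (j * P) r)) P∣k) (n∣m*n j)))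

  L/[1+j*P+pred[P]]≡L/P/[1+j] : ∀ j → L / suc (j * P + pred P) ≡ L / P / suc j
  L/[1+j*P+pred[P]]≡L/P/[1+j] j = begin
    L / suc (j * P + pred P) ≡⟨ /-congʳ (suc[m*n+pred[n]]≡[1+m]*n j P) ⟩
    L / (suc j * P)          ≡⟨ /-congʳ (*-comm (suc j) P) ⟩
    L / (P * suc j)          ≡⟨ m/n/o≡m/[n*o] L P (suc j) ⟨
    L / P / suc j            ∎
    where
    open ≡-Reasoning
    instance
      [1+j]*P≢0 : NonZero (suc j * P)
      [1+j]*P≢0 = m*n≢0 (suc j) P
      P*[1+j]≢0 : NonZero (P * suc j)
      P*[1+j]≢0 = m*n≢0 P (suc j)

  scaledH-block-ends : ∀ j → j * P ≤ N → scaledH L (j * P) ≡ scaledH (L / P) j [mod p ]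
  scaledH-block-ends zero    _          = ≡⇒≡-mod refl
  scaledH-block-ends (suc j) [1+j]P≤N = begin
    scaledH L (suc j * P)                                 ≡⟨ cong (scaledH L) last-before-block ⟨
    scaledH L (j * P + pred P) + L / suc (j * P + pred P) ≲⟨ ≡-mod-+ʳ _ (scaledH-within-block j (pred P) pred[P]<P jP+pred[P]≤N) ⟩
    scaledH L (j * P) + L / suc (j * P + pred P)          ≲⟨ ≡-mod-+ʳ _ (scaledH-block-ends j (≤-trans (m≤n+m (j * P) P) [1+j]P≤N)) ⟩
    scaledH (L / P) j + L / suc (j * P + pred P)          ≡⟨ cong (_+_ (scaledH (L / P) j)) (L/[1+j*P+pred[P]]≡L/P/[1+j] j) ⟩
    scaledH (L / P) (suc j)                               ∎
    where
    open ≡-mod-Reasoning p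
    last-before-block : suc (j * P + pred P) ≡ suc j * P
    last-before-block = suc[m*n+pred[n]]≡[1+m]*n j P
    pred[P]<P : pred P < P
    pred[P]<P = subst (pred P <_) (suc-pred P) (n<1+n (pred P))
    jP+pred[P]≤N : j * P + pred P ≤ N
    jP+pred[P]≤N = ≤-trans (n≤1+n _) (subst (_≤ N) (sym last-before-block) [1+j]P≤N)

  scaledH≡scaledH-per-block : ∀ j r → r < P → j * P + r ≤ N →
    scaledH L (j * P + r) ≡ scaledH (L / P) j [mod p ]
  scaledH≡scaledH-per-block j r r<P jP+r≤N = ≡-mod-trans
    (scaledH-within-block j r r<P jP+r≤N)
    (scaledH-block-ends j (≤-trans (m≤m+n (j * P) r) jP+r≤N))

module _ {p : ℕ} (p-prime : Prime p) where

  private instance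
    p≢0 : NonZero p
    p≢0 = prime⇒nonZero p-prime

  1<p : 1 < p
  1<p = nonTrivial⇒n>1 p {{prime⇒nonTrivial p-prime}}

  p∤1 : ¬ p ∣ 1
  p∤1 p∣1 = <⇒≢ 1<p (sym (∣1⇒≡1 p∣1))

  p^a∣m*n∧p∤n⇒p^a∣m : ∀ a {m n} → p ^ a ∣ m * n → ¬ p ∣ n → p ^ a ∣ m
  p^a∣m*n∧p∤n⇒p^a∣m zero    {m}     _ _ = 1∣ m
  p^a∣m*n∧p∤n⇒p^a∣m (suc a) {m} {n} p^[1+a]∣mn p∤n
    with euclidsLemma m n p-prime (∣-trans (m∣m*n (p ^ a)) p^[1+a]∣mn)
  ... | inj₂ p∣n = ⊥-elim (p∤n p∣n)
  ... | inj₁ (divides m' refl) = subst (p ^ suc a ∣_) (*-comm p m')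
        (*-monoʳ-∣ p (p^a∣m*n∧p∤n⇒p^a∣m a (*-cancelˡ-∣ p (subst (p * p ^ a ∣_) m'p*n≡p*m'n p^[1+a]∣mn)) p∤n))
    where
    m'p*n≡p*m'n : m' * p * n ≡ p * (m' * n)
    m'p*n≡p*m'n = trans (cong (_* n) (*-comm m' p)) (*-assoc p m' n)

  p-free-part : ∀ x .{{_ : NonZero x}} → ∃₂ λ i y → ¬ p ∣ y × x ≡ p ^ i * y
  p-free-part x = go x (<-wellFounded x)
    where
    go : ∀ x .{{_ : NonZero x}} → Acc _<_ x → ∃₂ λ i y → ¬ p ∣ y × x ≡ p ^ i * y
    go x (acc smaller) with p ∣? x
    ... | no p∤x = 0 , x , p∤x , sym (*-identityˡ x)
    ... | yes (divides x' refl) with go x' {{m*n≢0⇒m≢0 x'}} (smaller (m<m*n x' p {{m*n≢0⇒m≢0 x'}} 1<p))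
    ...   | i , y , p∤y , x'≡p^i*y = suc i , y , p∤y , (begin
            x' * p         ≡⟨ *-comm x' p ⟩
            p * x'         ≡⟨ cong (p *_) x'≡p^i*y ⟩
            p * (p ^ i * y) ≡⟨ *-assoc p (p ^ i) y ⟨
            p ^ suc i * y  ∎)
      where open ≡-Reasoning

  p^i∣p^a : ∀ {i a} → i ≤ a → p ^ i ∣ p ^ a
  p^i∣p^a {i} {a} i≤a = divides (p ^ (a ∸ i)) (begin
    p ^ a               ≡⟨ cong (p ^_) (m+[n∸m]≡n i≤a) ⟨
    p ^ (i + (a ∸ i))   ≡⟨ ^-distribˡ-+-* p i (a ∸ i) ⟩
    p ^ i * p ^ (a ∸ i) ≡⟨ *-comm (p ^ i) (p ^ (a ∸ i)) ⟩
    p ^ (a ∸ i) * p ^ i ∎)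
    where open ≡-Reasoning

  D∣p^a*p-free : ∀ a n → n < p ^ suc a → ∃[ R ] ¬ p ∣ R × D n ∣ p ^ a * R
  D∣p^a*p-free a zero    _ = 1 , p∤1 , 1∣ _
  D∣p^a*p-free a (suc n) 1+n<p^[1+a]
    with D∣p^a*p-free a n (<-trans (n<1+n n) 1+n<p^[1+a]) | p-free-part (suc n)
  ... | R , p∤R , D∣p^aR | i , y , p∤y , 1+n≡p^i*y =
    R * y , p∤R*y , lcm-least (∣-trans D∣p^aR (*-monoʳ-∣ (p ^ a) (m∣m*n y))) 1+n∣p^aRy
    where
    p∤R*y : ¬ p ∣ R * y
    p∤R*y p∣Ry = [ p∤R , p∤y ]′ (euclidsLemma R y p-prime p∣Ry)
    instance
      y≢0 : NonZero y
      y≢0 = m*n≢0⇒n≢0 (p ^ i) {{subst NonZero 1+n≡p^i*y _}}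
    i≤a : i ≤ a
    i≤a = ≮⇒≥ λ a<i → <⇒≱ 1+n<p^[1+a] (begin
      p ^ suc a ≤⟨ ^-monoʳ-≤ p a<i ⟩
      p ^ i     ≤⟨ m≤m*n (p ^ i) y ⟩
      p ^ i * y ≡⟨ 1+n≡p^i*y ⟨
      suc n     ∎)
      where open ≤-Reasoning
    1+n∣p^aRy : suc n ∣ p ^ a * (R * y)
    1+n∣p^aRy = subst (_∣ p ^ a * (R * y)) (sym 1+n≡p^i*y) (*-pres-∣ (p^i∣p^a i≤a) (n∣m*n R))

  p^[1+a]∤D : ∀ a n → n < p ^ suc a → ¬ p ^ suc a ∣ D n
  p^[1+a]∤D a n n<p^[1+a] p^[1+a]∣D with D∣p^a*p-free a n n<p^[1+a]
  ... | R , p∤R , D∣p^aR =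
    p∤R (*-cancelˡ-∣ (p ^ a) {{m^n≢0 p a}} (subst (_∣ p ^ a * R) (*-comm p (p ^ a)) (∣-trans p^[1+a]∣D D∣p^aR)))

  p∤D : ∀ n → n < p → ¬ p ∣ D n
  p∤D n n<p p∣D = p^[1+a]∤D 0 n (subst (n <_) (sym (*-identityʳ p)) n<p) (subst (_∣ D n) (sym (*-identityʳ p)) p∣D)

  p^a∣m∧p^a∤n⇒p∣m/n : ∀ a {m n} .{{_ : NonZero n}} → n ∣ m → p ^ a ∣ m → ¬ p ^ a ∣ n → p ∣ m / n
  p^a∣m∧p^a∤n⇒p∣m/n a {n = n} (divides t refl) p^a∣tn p^a∤n with p ∣? t
  ... | yes p∣t = subst (p ∣_) (sym (m*n/n≡m t n)) p∣t
  ... | no  p∤t = ⊥-elim (p^a∤n (p^a∣m*n∧p∤n⇒p^a∣m a (subst (p ^ a ∣_) (*-comm t n) p^a∣tn) p∤t))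

  module _ {a m n : ℕ} .{{_ : NonZero m}} (mp^a≤n : m * p ^ a ≤ n) (n<[1+m]p^a : n < suc m * p ^ a) where

    private instance
      p^a≢0 : NonZero (p ^ a)
      p^a≢0 = m^n≢0 p a

    p^a∣D : p ^ a ∣ D n
    p^a∣D = k∣D n (≤-trans (m≤n*m (p ^ a) m) mp^a≤n)

    D/p^a≢0 : NonZero (D n / p ^ a)
    D/p^a≢0 = >-nonZero (m≥n⇒m/n>0 (∣⇒≤ {{D≢0 n}} p^a∣D))

    scaledH-D≡scaledH-D/p^a : scaledH (D n) n ≡ scaledH (D n / p ^ a) m [mod p ]
    scaledH-D≡scaledH-D/p^a = subst (λ k → scaledH (D n) k ≡ scaledH (D n / p ^ a) m [mod p ]) mp^a+r≡n
      (scaledH≡scaledH-per-block (λ k k≤n p^a∤k → p^a∣m∧p^a∤n⇒p∣m/n a (k∣D n k≤n) p^a∣D p^a∤k) m r r<p^a (≤-reflexive mp^a+r≡n))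
      where
      r = n ∸ m * p ^ a
      mp^a+r≡n : m * p ^ a + r ≡ n
      mp^a+r≡n = m+[n∸m]≡n mp^a≤n
      r<p^a : r < p ^ a
      r<p^a = +-cancelˡ-< (m * p ^ a) r (p ^ a)
                (subst (_< m * p ^ a + p ^ a) (sym mp^a+r≡n) (subst (n <_) (+-comm (p ^ a) (m * p ^ a)) n<[1+m]p^a))

    ∣c∣*D/p^a≡scaledH*d : ℤ.∣ c m ∣ * (D n / p ^ a) ≡ scaledH (D n / p ^ a) m * d m
    ∣c∣*D/p^a≡scaledH*d = ∣c∣*L≡scaledH*d m (D n / p ^ a) {{D/p^a≢0}}
      λ k k≤m → m*n∣o⇒m∣o/n k (p ^ a) (k∣D n {{m*n≢0 k (p ^ a)}} (≤-trans (*-monoˡ-≤ (p ^ a) k≤m) mp^a≤n))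

    p∣c⇒p∣scaledH-D : m < p → p ∣ ℤ.∣ c m ∣ → p ∣ scaledH (D n) n
    p∣c⇒p∣scaledH-D m<p p∣c = Equivalence.from (∣-resp-≡-mod scaledH-D≡scaledH-D/p^a) p∣scaledH-D/p^a
      where
      p∤d : ¬ p ∣ d m
      p∤d p∣d = p∤D m m<p (∣-trans p∣d (d∣D m))
      p∣scaledH-D/p^a : p ∣ scaledH (D n / p ^ a) m
      p∣scaledH-D/p^a with euclidsLemma (scaledH (D n / p ^ a) m) (d m) p-prime
                             (subst (p ∣_) ∣c∣*D/p^a≡scaledH*d (∣m⇒∣m*n (D n / p ^ a) p∣c))
      ... | inj₁ p∣scaledH = p∣scaledH
      ... | inj₂ p∣d       = ⊥-elim (p∤d p∣d)

    p∣scaledH-D⇒p∣c : n < p ^ suc a → p ∣ scaledH (D n) n → p ∣ ℤ.∣ c m ∣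
    p∣scaledH-D⇒p∣c n<p^[1+a] p∣scaledH-D with euclidsLemma ℤ.∣ c m ∣ (D n / p ^ a) p-prime
      (subst (p ∣_) (sym ∣c∣*D/p^a≡scaledH*d)
        (∣m⇒∣m*n (d m) (Equivalence.to (∣-resp-≡-mod scaledH-D≡scaledH-D/p^a) p∣scaledH-D)))
    ... | inj₁ p∣c   = p∣c
    ... | inj₂ p∣D/p^a = ⊥-elim (p^[1+a]∤D a n n<p^[1+a]
                            (subst (p ^ suc a ∣_) (m/n*n≡m p^a∣D) (*-pres-∣ p∣D/p^a (∣-refl {p ^ a}))))

  p∣q⇔p∣D×p∣scaledH-D : ∀ n → p ∣ q n ⇔ (p ∣ D n × p ∣ scaledH (D n) n)
  p∣q⇔p∣D×p∣scaledH-D n = mk⇔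
    (λ p∣q → subst (p ∣_) (sym (D≡q*d n)) (∣m⇒∣m*n (d n) p∣q)
           , subst (p ∣_) (sym (scaledH-D≡∣c∣*q n)) (∣n⇒∣m*n ℤ.∣ c n ∣ p∣q))
    λ (p∣D , p∣scaledH) → p∣q p∣D p∣scaledH
    where
    p∣q : p ∣ D n → p ∣ scaledH (D n) n → p ∣ q n
    p∣q p∣D p∣scaledH with euclidsLemma (q n) (d n) p-prime (subst (p ∣_) (D≡q*d n) p∣D)
    ... | inj₁ p∣q = p∣q
    ... | inj₂ p∣d with euclidsLemma ℤ.∣ c n ∣ (q n) p-prime (subst (p ∣_) (scaledH-D≡∣c∣*q n) p∣scaledH)
    ...   | inj₂ p∣q = p∣q
    ...   | inj₁ p∣c = ⊥-elim (<⇒≢ 1<p (sym (coprime-↥-↧ (H n) (p∣c , p∣d))))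

  p^a≤n<p^[1+a] : ∀ n .{{_ : NonZero n}} → ∃[ a ] p ^ a ≤ n × n < p ^ suc a
  p^a≤n<p^[1+a] 1 = 0 , ≤-refl , subst (1 <_) (sym (*-identityʳ p)) 1<p
  p^a≤n<p^[1+a] (suc n@(suc _)) with p^a≤n<p^[1+a] n
  ... | a , p^a≤n , n<p^[1+a] with suc n <? p ^ suc a
  ...   | yes 1+n<p^[1+a] = a , m≤n⇒m≤1+n p^a≤n , 1+n<p^[1+a]
  ...   | no  1+n≮p^[1+a] = suc a , ≮⇒≥ 1+n≮p^[1+a] , (begin-strict
          suc n           ≤⟨ n<p^[1+a] ⟩
          p ^ suc a       <⟨ m<m*n (p ^ suc a) p {{m^n≢0 p (suc a)}} 1<p ⟩
          p ^ suc a * p   ≡⟨ *-comm (p ^ suc a) p ⟩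
          p * p ^ suc a   ∎)
    where open ≤-Reasoning

  block⊆Q : ∀ m → 1 < m × m < p × p ∣ ℤ.∣ c m ∣ →
    ∀ n a → 1 ≤ a → m * p ^ a ≤ n → n < suc m * p ^ a → 1 ≤ n × p ∣ q n
  block⊆Q m@(suc _) (_ , m<p , p∣c) n a@(suc a') _ mp^a≤n n<[1+m]p^a =
    ≤-trans (>-nonZero⁻¹ (m * p ^ a) {{m*n≢0 m (p ^ a) {{_}} {{m^n≢0 p a}}}}) mp^a≤n ,
    Equivalence.from (p∣q⇔p∣D×p∣scaledH-D n)
      ( ∣-trans (m∣m*n (p ^ a')) (p^a∣D {a = a} {m = m} mp^a≤n n<[1+m]p^a)
      , p∣c⇒p∣scaledH-D {a = a} {m = m} mp^a≤n n<[1+m]p^a m<p p∣c)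

  Q⊆blocks : ∀ n → 1 ≤ n → p ∣ q n →
    ∃[ m ] (1 < m × m < p × p ∣ ℤ.∣ c m ∣) × ∃[ a ] 1 ≤ a × m * p ^ a ≤ n × n < suc m * p ^ a
  Q⊆blocks n@(suc _) _ p∣q with Equivalence.to (p∣q⇔p∣D×p∣scaledH-D n) p∣q | p^a≤n<p^[1+a] n
  ... | p∣D , _         | zero , _ , n<p =
    ⊥-elim (p∤D n (subst (n <_) (*-identityʳ p) n<p) p∣D)
  ... | _   , p∣scaledH | a@(suc _) , p^a≤n , n<p^[1+a] =
    m , (1<m , m<p , p∣c) , a , s≤s z≤n , mp^a≤n , n<[1+m]p^a
    where
    instance
      p^a≢0 : NonZero (p ^ a)
      p^a≢0 = m^n≢0 p a
    m = n / p ^ a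
    instance
      m≢0 : NonZero m
      m≢0 = >-nonZero (m≥n⇒m/n>0 p^a≤n)
    mp^a≤n : m * p ^ a ≤ n
    mp^a≤n = m/n*n≤m n (p ^ a)
    n<[1+m]p^a : n < suc m * p ^ a
    n<[1+m]p^a = m<[1+m/n]*n n (p ^ a)
    m<p : m < p
    m<p = m<n*o⇒m/o<n n<p^[1+a]
    p∣c : p ∣ ℤ.∣ c m ∣
    p∣c = p∣scaledH-D⇒p∣c {a = a} mp^a≤n n<[1+m]p^a n<p^[1+a] p∣scaledH
    1<m : 1 < m
    1<m = ≤∧≢⇒< (>-nonZero⁻¹ m) λ 1≡m → p∤1 (subst (λ k → p ∣ ℤ.∣ c k ∣) (sym 1≡m) p∣c)

theorem2 : (p : ℕ) → Prime p → ¬ (2 ∣ p) →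
    ((m : ℕ) → (1 < m × m < p × (+ p) ∣ℤ c m) →
      (n a : ℕ) → 1 ≤ a → m * p ^ a ≤ n → n < suc m * p ^ a →
      (1 ≤ n × p ∣ q n))
    ×
    ((n : ℕ) → 1 ≤ n → p ∣ q n →
      Σ ℕ λ m → (1 < m × m < p × (+ p) ∣ℤ c m) ×
        Σ ℕ λ a → 1 ≤ a × m * p ^ a ≤ n × n < suc m * p ^ a)
theorem2 p p-prime _ = block⊆Q p-prime , Q⊆blocks p-prime
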